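{- Let $k\geq 1$ and $m\geq k+2$, and let $w\in\{1,\dots,k+1\}^*$. Then the $m$-cyclic $w$-word $C_m(w)$ avoids the formula $\phi_k$ if and only if for every $j\in\{1,\dots,k\}$, the word $w$ (viewed as a word over the alphabet $\{1,\dots,k+1\}$) has no factor of the form $x'\alpha_1\alpha_2\cdots\alpha_j x''$ such that all of the following hold: (i) each $\alpha_i$ is a single letter, i.e. $\alpha_i\in\{1,\dots,k+1\}$ for $i=1,\dots,j$; (ii) $\sum_{i=1}^j \alpha_i\geq k$ (as integers); (iii) $|x'|=|x''|=n$ for some $n$ with $n\equiv m-j \pmod m$; (iv) writing $x'=x'_1\cdots x'_n$ and $x''=x''_1\cdots x''_n$ (letters $x'_i,x''_i\in\{1,\dots,k+1\}$), we have $x'_1\geq x''_1$, $x'_n\leq x''_n$, and $x'_i=x''_i$ for all $i\in\{2,\dots,n-1\}$.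
   Context: Patterns with reversal: let $\Sigma$ be a set of variables and $\Sigma^R=\{x^R: x\in\Sigma\}$ a disjoint copy (the reversed variables). For words over any alphabet, $(a_1\cdots a_n)^R=a_n\cdots a_1$. A morphism $h:(\Sigma\cup\Sigma^R)^*\to A^*$ respects reversal if $h(x^R)=h(x)^R$ for all $x\in\Sigma$. A formula with reversal is a finite set of words (fragments) over $\Sigma\cup\Sigma^R$. A formula $\phi$ occurs in a word $u$ if there is a non-erasing morphism $h$ respecting reversal such that $h(p)$ is a factor of $u$ for every fragment $p$ of $\phi$; otherwise $u$ avoids $\phi$. For $k\geq1$, $\phi_k$ is the formula with reversal with fragments $x y_1 y_2\cdots y_k x$, $y_1^R$, $y_2^R$, $\dots$, $y_k^R$ (variables $x,y_1,\dots,y_k$). Cyclic words: for a word $w=w_1w_2\cdots$ whose letters are positive integers and distinct letters $a_1,\dots,a_m$, the $(a_1,\dots,a_m)$-cyclic $w$-word is $C_m(w)=a_1^{w_1}a_2^{w_2}\cdots a_m^{w_m}a_1^{w_{m+1}}a_2^{w_{m+2}}\cdots a_m^{w_{2m}}\cdots$, i.e. the $t$-th letter of $w$ determines the exponent of the letter $a_{((t-1)\bmod m)+1}$; any word obtained from it by renaming letters bijectively is called an $m$-cyclic $w$-word. -}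

module Defs where

open import Data.Nat using (ℕ; zero; suc; _+_; _∸_; _≤_; _<_; _<ᵇ_)
open import Data.Bool using (if_then_else_)
open import Data.Fin using (Fin; toℕ) renaming (zero to fzero; suc to fsuc)
open import Data.List using (List; []; _∷_; _++_; replicate; reverse; concatMap; map; [_]; allFin)
open import Data.List.Relation.Unary.All using (All)
open import Data.Vec using (Vec; lookup; toList)
import Data.Vec as Vec
open import Data.Integer using (+_; _-_)
open import Data.Integer.Divisibility using () renaming (_∣_ to _∣ℤ_)
open import Data.Sum using (_⊎_; inj₁; inj₂)
open import Data.Product using (Σ; _×_; ∃)
open import Relation.Binary.PropositionalEquality using (_≡_)
open import Relation.Nullary using (¬_)

Factor : {A : Set} → List A → List A → Set
Factor u v = ∃ λ p → ∃ λ s → v ≡ p ++ u ++ s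

NonEmpty : {A : Set} → List A → Set
NonEmpty xs = ¬ (xs ≡ [])

-- Formulas with reversal over the variable set Σ = Fin v.
-- A pattern letter is  inj₁ x  (the variable x) or  inj₂ x  (the variable x^R).

PLetter : ℕ → Set
PLetter v = Fin v ⊎ Fin v

Formula : ℕ → Set
Formula v = List (List (PLetter v))

extend : {A : Set} {v : ℕ} → (Fin v → List A) → PLetter v → List A
extend h (inj₁ x) = h x
extend h (inj₂ x) = reverse (h x)

image : {A : Set} {v : ℕ} → (Fin v → List A) → List (PLetter v) → List A
image h p = concatMap (extend h) p

Occurs : {A : Set} {v : ℕ} → Formula v → List A → Set
Occurs {A} {v} φ u =
  Σ (Fin v → List A) λ h → ((x : Fin v) → NonEmpty (h x)) × All (λ p → Factor (image h p) u) φ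

Avoids : {A : Set} {v : ℕ} → Formula v → List A → Set
Avoids φ u = ¬ Occurs φ u

-- φ_k : variables x = fzero, y_i = fsuc i (i : Fin k);
-- fragments  x y_1 ... y_k x,  y_1^R, ..., y_k^R.
phi : (k : ℕ) → Formula (suc k)
phi k = ((inj₁ fzero ∷ map (λ i → inj₁ (fsuc i)) (allFin k)) ++ [ inj₁ fzero ])
      ∷ map (λ i → [ inj₂ (fsuc i) ]) (allFin k)

-- Cyclic words.  The letters a_1,...,a_m are taken to be 0,...,m-1;
-- the t-th letter of w (t = 1,2,...) is the exponent of letter (t-1) mod m.

nextLetter : ℕ → ℕ → ℕ
nextLetter m c = if suc c <ᵇ m then suc c else 0

cyclicFrom : ℕ → ℕ → List ℕ → List ℕ
cyclicFrom m c [] = []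
cyclicFrom m c (e ∷ w) = replicate e c ++ cyclicFrom m (nextLetter m c) w

cyclic : ℕ → List ℕ → List ℕ
cyclic m w = cyclicFrom m 0 w

Congruent : ℕ → ℕ → ℕ → Set
Congruent a b m = (+ m) ∣ℤ ((+ a) - (+ b))

-- Condition (iv), with 0-based indices (1-based index i ↔ 0-based i-1).
EndCond : {n : ℕ} → Vec ℕ n → Vec ℕ n → Set
EndCond {n} x' x'' = (i : Fin n) →
    (toℕ i ≡ 0 → lookup x'' i ≤ lookup x' i)
  × (suc (toℕ i) ≡ n → lookup x' i ≤ lookup x'' i)
  × (1 ≤ toℕ i → suc (toℕ i) < n → lookup x' i ≡ lookup x'' i)

BadFactor : (k m j : ℕ) → List ℕ → Set
BadFactor k m j w =
  Σ ℕ λ n → Σ (Vec ℕ n) λ x' → Σ (Vec ℕ j) λ α → Σ (Vec ℕ n) λ x'' →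
      Factor (toList x' ++ toList α ++ toList x'') w
    × All (λ a → 1 ≤ a × a ≤ suc k) (toList α)
    × k ≤ Vec.sum α
    × Congruent n (m ∸ j) m
    × EndCond x' x''

-- Consecutive letters of C_m(w) are equal or cyclically consecutive, so, as m ≥ 3, a factor whose
-- reversal is also a factor is constant; and runs have length at most k + 1. In an occurrence of φ_k
-- the images of the y_i are therefore constant, so Y = h(y₁⋯y_k) has at least k letters but fewer than
-- k changes of letter. Sliding the occurrence X Y X one letter at a time keeps these properties and
-- makes both ends of Y changes of letter; a single-letter X is impossible, since x Y x would be a run of
-- length at least k + 2. Then Y is made of j ≤ k whole runs α with Σα ≥ k. The first copy of X is a
-- suffix of some runs x′ of w and the second a prefix of runs x″; both start with the same letter, so
-- m divides |x′| + j, and they share their inner runs, which is condition (iv). Conversely such a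
-- factor of w yields X and Y directly, and the j runs of Y can be cut into exactly k constant pieces.

module Submission where

open import Defs
open import Data.Bool using (true; false; T)
open import Data.Empty using (⊥; ⊥-elim)
open import Data.Fin using (Fin; toℕ) renaming (zero to fzero; suc to fsuc)
open import Data.Integer using (-_; _⊖_) renaming (+_ to ⁺_; _+_ to _+ℤ_; _-_ to _-ℤ_)
import Data.Integer.Divisibility.Signed as ℤ
import Data.Integer.Properties as ℤ
open import Data.List
  using (List; []; _∷_; _++_; _∷ʳ_; [_]; replicate; length; reverse; concat; concatMap; map; head; tabulate; allFin)
open import Data.List.Properties
  using ( ++-assoc; ++-identityʳ; length-++; length-replicate; length-tabulate; ∷-injective; ∷ʳ-injective
        ; unfold-reverse; reverse-++; concatMap-++; concatMap-map; map-tabulate)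
open import Data.List.Relation.Unary.All as All using (All; []; _∷_)
import Data.List.Relation.Unary.All.Properties as Allₚ
open import Data.List.Relation.Unary.Linked as Linked using (Linked; []; [-]; _∷_; _∷′_)
open import Data.Maybe using (just)
open import Data.Maybe.Properties using (just-injective)
open import Data.Maybe.Relation.Binary.Connected using (Connected; just; just-nothing)
open import Data.Nat
open import Data.Nat.DivMod
open import Data.Nat.Divisibility using (_∣_; ∣⇒≤; m%n≡0⇒n∣m)
open import Data.Nat.ListAction using (sum)
open import Data.Nat.Properties
open import Data.Product using (Σ; ∃; ∃₂; _×_; _,_; proj₁; proj₂; uncurry)
open import Data.Sum using (_⊎_; inj₁; inj₂)
open import Data.Vec using (Vec; lookup; toList; fromList) renaming ([] to []ᵥ; _∷_ to _∷ᵥ_; _∷ʳ_ to _∷ʳᵥ_)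
import Data.Vec as Vec
open import Data.Vec.Functional using () renaming (_∷_ to _∷ᶠ_)
open import Data.Vec.Properties using (toList∘fromList; length-toList)
open import Function.Base using (_∘_)
open import Function.Bundles using (_⇔_; mk⇔; Equivalence)
open import Relation.Binary.PropositionalEquality hiding ([_])
open import Relation.Nullary using (¬_; yes; no; contradiction)

module _ {A : Set} where

  ∷ʳ-nonEmpty : ∀ (xs : List A) x → NonEmpty (xs ∷ʳ x)
  ∷ʳ-nonEmpty []      x ()
  ∷ʳ-nonEmpty (_ ∷ _) x ()

  length-∷ʳ : ∀ (xs : List A) x → length (xs ∷ʳ x) ≡ suc (length xs)
  length-∷ʳ xs x = trans (length-++ xs) (+-comm (length xs) 1)

  replicate-∷ʳ : ∀ n (c : A) → replicate (suc n) c ≡ replicate n c ∷ʳ c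
  replicate-∷ʳ zero    c = refl
  replicate-∷ʳ (suc n) c = cong (c ∷_) (replicate-∷ʳ n c)

  replicate-+ : ∀ a b (c : A) → replicate (a + b) c ≡ replicate a c ++ replicate b c
  replicate-+ zero    b c = refl
  replicate-+ (suc a) b c = cong (c ∷_) (replicate-+ a b c)

  reverse-replicate : ∀ n (c : A) → reverse (replicate n c) ≡ replicate n c
  reverse-replicate zero    c = refl
  reverse-replicate (suc n) c =
    trans (unfold-reverse c (replicate n c)) (trans (cong (_∷ʳ c) (reverse-replicate n c)) (sym (replicate-∷ʳ n c)))

  last-replicate : ∀ (p C : List A) x a c → 1 ≤ a → p ∷ʳ x ≡ C ++ replicate a c → x ≡ c
  last-replicate p C x (suc a) c _ eq = proj₂ (∷ʳ-injective p (C ++ replicate a c) (begin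
    p ∷ʳ x                    ≡⟨ eq ⟩
    C ++ replicate (suc a) c  ≡⟨ cong (C ++_) (replicate-∷ʳ a c) ⟩
    C ++ replicate a c ∷ʳ c   ≡⟨ ++-assoc C (replicate a c) [ c ] ⟨
    (C ++ replicate a c) ∷ʳ c ∎))
    where open ≡-Reasoning

  replicate-++-split : ∀ e (c : A) R p q → replicate e c ++ R ≡ p ++ q →
      (∃₂ λ a b → a + b ≡ e × p ≡ replicate a c × q ≡ replicate b c ++ R)
    ⊎ (∃ λ p′ → NonEmpty p′ × p ≡ replicate e c ++ p′ × R ≡ p′ ++ q)
  replicate-++-split zero    c R []      q eq = inj₁ (0 , 0 , refl , refl , sym eq)
  replicate-++-split zero    c R (x ∷ p) q eq = inj₂ (x ∷ p , (λ ()) , refl , eq)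
  replicate-++-split (suc e) c R []      q eq = inj₁ (0 , suc e , refl , refl , sym eq)
  replicate-++-split (suc e) c R (x ∷ p) q eq with refl , eq′ ← ∷-injective eq
    with replicate-++-split e c R p q eq′
  ... | inj₁ (a , b , a+b≡e , refl , q≡) = inj₁ (suc a , b , cong suc a+b≡e , refl , q≡)
  ... | inj₂ (p′ , p′≢[] , refl , R≡)   = inj₂ (p′ , p′≢[] , refl , R≡)

  replicate-++-injective : ∀ {c : A} e e′ {xs ys} → head xs ≢ just c → head ys ≢ just c →
                           replicate e c ++ xs ≡ replicate e′ c ++ ys → e ≡ e′ × xs ≡ ys
  replicate-++-injective zero    zero     _   _   eq = refl , eq
  replicate-++-injective zero    (suc e′) xs≢ _   eq = contradiction (cong head eq) xs≢
  replicate-++-injective (suc e) zero     _   ys≢ eq = contradiction (cong head (sym eq)) ys≢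
  replicate-++-injective (suc e) (suc e′) xs≢ ys≢ eq
    with refl , eq′ ← replicate-++-injective e e′ xs≢ ys≢ (proj₂ (∷-injective eq)) = refl , eq′

  replicate-++-≤ : ∀ {c : A} e e′ {xs ys} → head ys ≢ just c →
                   replicate e c ++ xs ≡ replicate e′ c ++ ys → e ≤ e′
  replicate-++-≤ zero    e′       _   _  = z≤n
  replicate-++-≤ (suc e) zero     ys≢ eq = contradiction (cong head (sym eq)) ys≢
  replicate-++-≤ (suc e) (suc e′) ys≢ eq = s≤s (replicate-++-≤ e e′ ys≢ (proj₂ (∷-injective eq)))

  replicate-++-≢[] : ∀ {n} (c : A) l → 1 ≤ n → NonEmpty (replicate n c ++ l)
  replicate-++-≢[] {suc n} c l _ ()

  factor-trans : ∀ {u v x : List A} → Factor x v → Factor v u → Factor x u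
  factor-trans {x = x} (p′ , s′ , refl) (p , s , refl) =
    p ++ p′ , s′ ++ s , trans (cong (p ++_) (trans (++-assoc p′ (x ++ s′) s) (cong (p′ ++_) (++-assoc x s′ s))))
                              (sym (++-assoc p p′ _))

  factor-concat-tabulate : ∀ {n} (G : Fin n → List A) i → Factor (G i) (concat (tabulate G))
  factor-concat-tabulate G fzero    = [] , concat (tabulate (G ∘ fsuc)) , refl
  factor-concat-tabulate G (fsuc i) with p , s , eq ← factor-concat-tabulate (G ∘ fsuc) i =
    G fzero ++ p , s , trans (cong (G fzero ++_) eq) (sym (++-assoc (G fzero) p _))

  Linked-++⁻ˡ : ∀ {R : A → A → Set} xs ys → Linked R (xs ++ ys) → Linked R xs
  Linked-++⁻ˡ []           ys _          = []
  Linked-++⁻ˡ (x ∷ [])     ys _          = [-]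
  Linked-++⁻ˡ (x ∷ y ∷ xs) ys (r ∷ rest) = r ∷ Linked-++⁻ˡ (y ∷ xs) ys rest

  Linked-++⁻ʳ : ∀ {R : A → A → Set} xs ys → Linked R (xs ++ ys) → Linked R ys
  Linked-++⁻ʳ []       ys rs = rs
  Linked-++⁻ʳ (x ∷ xs) ys rs = Linked-++⁻ʳ xs ys (Linked.tail rs)

  Linked-factor : ∀ {R : A → A → Set} {v u} → Factor v u → Linked R u → Linked R v
  Linked-factor {v = v} (p , s , refl) rs = Linked-++⁻ˡ v s (Linked-++⁻ʳ p (v ++ s) rs)

  Linked-concat⁻ : ∀ {R : A → A → Set} xss → Linked R (concat xss) → All (Linked R) xss
  Linked-concat⁻ []         _     = []
  Linked-concat⁻ (xs ∷ xss) walk =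
    Linked-++⁻ˡ xs (concat xss) walk ∷ Linked-concat⁻ xss (Linked-++⁻ʳ xs (concat xss) walk)

  length-concat-≥ : ∀ (xss : List (List A)) → All NonEmpty xss → length xss ≤ length (concat xss)
  length-concat-≥ []               []        = z≤n
  length-concat-≥ ([] ∷ xss)       (ne ∷ _)  = contradiction refl ne
  length-concat-≥ ((x ∷ xs) ∷ xss) (_ ∷ nes) = s≤s (begin
    length xss                      ≤⟨ length-concat-≥ xss nes ⟩
    length (concat xss)             ≤⟨ m≤n+m _ (length xs) ⟩
    length xs + length (concat xss) ≡⟨ length-++ xs ⟨
    length (xs ++ concat xss)       ∎)
    where open ≤-Reasoning

  Run : List A → Set
  Run g = ∃₂ λ e c → g ≡ replicate (suc e) c

  run≢[] : ∀ {g} → Run g → NonEmpty g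
  run≢[] (e , c , refl) ()

  run-reverse : ∀ {g} → Run g → reverse g ≡ g
  run-reverse (e , c , refl) = reverse-replicate (suc e) c

  refine : ∀ q (gs : List (List A)) → All Run gs → length gs ≤ q → q ≤ length (concat gs) →
           Σ (Fin q → List A) λ G → concat (tabulate G) ≡ concat gs × (∀ i → Run (G i))
  refine zero    []       _ _ _ = (λ ()) , refl , λ ()
  refine (suc q) []       _ _ ()
  refine (suc q) (g ∷ gs) (run@(e , c , refl) ∷ runs) (s≤s |gs|≤q) q<|g++gs| with q ≤? length (concat gs)
  ... | yes q≤ with G , G≡ , G-runs ← refine q gs runs |gs|≤q q≤ =
    (g ∷ᶠ G) , cong (g ++_) G≡ , λ { fzero → run ; (fsuc i) → G-runs i }
  ... | no q≰ with e
  ...   | zero   = contradiction (s≤s⁻¹ q<|g++gs|) q≰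
  ...   | suc e′ with G , G≡ , G-runs ← refine q (replicate (suc e′) c ∷ gs) ((e′ , c , refl) ∷ runs)
                       (≤-trans (s≤s (length-concat-≥ gs (All.map run≢[] runs))) (≰⇒> q≰)) (s≤s⁻¹ q<|g++gs|) =
    ([ c ] ∷ᶠ G) , cong (c ∷_) G≡ , λ { fzero → 0 , c , refl ; (fsuc i) → G-runs i }

-- Changes of letter

lastOf : ℕ → List ℕ → ℕ
lastOf a []      = a
lastOf a (b ∷ l) = lastOf b l

lastOf-∷ʳ : ∀ a l x → lastOf a (l ∷ʳ x) ≡ x
lastOf-∷ʳ a []      x = refl
lastOf-∷ʳ a (b ∷ l) x = lastOf-∷ʳ b l x

∷-lastOf : ∀ a l → ∃ λ l₀ → a ∷ l ≡ l₀ ∷ʳ lastOf a l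
∷-lastOf a []      = [] , refl
∷-lastOf a (b ∷ l) with l₀ , eq ← ∷-lastOf b l = a ∷ l₀ , cong (a ∷_) eq

changesFrom : ℕ → List ℕ → ℕ
changesFrom a []      = 0
changesFrom a (b ∷ l) with a ≟ b
... | yes _ = changesFrom b l
... | no  _ = suc (changesFrom b l)

changes : List ℕ → ℕ
changes []      = 0
changes (a ∷ l) = changesFrom a l

changesFrom-++ : ∀ a A B → changesFrom a (A ++ B) ≡ changesFrom a A + changesFrom (lastOf a A) B
changesFrom-++ a []      B = refl
changesFrom-++ a (b ∷ A) B with a ≟ b
... | yes _ = changesFrom-++ b A B
... | no  _ = cong suc (changesFrom-++ b A B)

changesFrom-≤ : ∀ a l → changesFrom a l ≤ suc (changes l)
changesFrom-≤ a []      = z≤n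
changesFrom-≤ a (b ∷ l) with a ≟ b
... | yes _ = n≤1+n _
... | no  _ = ≤-refl

changes-++ : ∀ A B → changes (A ++ B) ≤ changes A + suc (changes B)
changes-++ []      B = n≤1+n _
changes-++ (a ∷ A) B rewrite changesFrom-++ a A B = +-monoʳ-≤ (changesFrom a A) (changesFrom-≤ (lastOf a A) B)

changesFrom-replicate-++ : ∀ a e l → changesFrom a (replicate e a ++ l) ≡ changesFrom a l
changesFrom-replicate-++ a zero    l = refl
changesFrom-replicate-++ a (suc e) l with a ≟ a
... | yes _   = changesFrom-replicate-++ a e l
... | no  a≢a = contradiction refl a≢a

changesFrom≡0 : ∀ a l → changesFrom a l ≡ 0 → l ≡ replicate (length l) a
changesFrom≡0 a []      _  = refl
changesFrom≡0 a (b ∷ l) eq with a ≟ b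
... | yes refl = cong (a ∷_) (changesFrom≡0 a l eq)

changes-∷ʳ-lastOf : ∀ y Y → changes (y ∷ Y ∷ʳ lastOf y Y) ≡ changes (y ∷ Y)
changes-∷ʳ-lastOf y Y = trans (changesFrom-++ y Y [ lastOf y Y ]) (trans (cong (changesFrom y Y +_) stay) (+-identityʳ _))
  where
  stay : changesFrom (lastOf y Y) [ lastOf y Y ] ≡ 0
  stay with lastOf y Y ≟ lastOf y Y
  ... | yes _   = refl
  ... | no  l≢l = contradiction refl l≢l

changes-concat-tabulate : ∀ {n} (G : Fin n → List ℕ) → 1 ≤ n → (∀ i → changes (G i) ≡ 0) →
                          changes (concat (tabulate G)) < n
changes-concat-tabulate {suc zero}    G _ constant =
  s≤s (≤-reflexive (trans (cong changes (++-identityʳ (G fzero))) (constant fzero)))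
changes-concat-tabulate {suc (suc n)} G _ constant = s≤s (begin
  changes (G fzero ++ rest)              ≤⟨ changes-++ (G fzero) rest ⟩
  changes (G fzero) + suc (changes rest) ≡⟨ cong (_+ suc (changes rest)) (constant fzero) ⟩
  suc (changes rest)                     ≤⟨ changes-concat-tabulate (G ∘ fsuc) (s≤s z≤n) (constant ∘ fsuc) ⟩
  suc n                                  ∎)
  where
  open ≤-Reasoning
  rest = concat (tabulate (G ∘ fsuc))

-- Letters modulo m

advance : ℕ → ℕ → ℕ → ℕ
advance m zero    c = c
advance m (suc r) c = advance m r (nextLetter m c)

advance-+ : ∀ m r s c → advance m (r + s) c ≡ advance m s (advance m r c)
advance-+ m zero    s c = refl
advance-+ m (suc r) s c = advance-+ m r s (nextLetter m c)

advance-suc : ∀ m r c → advance m (suc r) c ≡ nextLetter m (advance m r c)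
advance-suc m zero    c = refl
advance-suc m (suc r) c = advance-suc m r (nextLetter m c)

module _ {m : ℕ} .{{_ : NonZero m}} where

  nextLetter≡suc% : ∀ {c} → c < m → nextLetter m c ≡ suc c % m
  nextLetter≡suc% {c} c<m with suc c <ᵇ m in eq
  ... | true  = sym (m<n⇒m%n≡m (<ᵇ⇒< (suc c) m (subst T (sym eq) _)))
  ... | false with m≤n⇒m<n∨m≡n c<m
  ...   | inj₁ c+1<m = contradiction (<⇒<ᵇ c+1<m) (subst T eq)
  ...   | inj₂ refl  = sym (n%n≡0 m)

  nextLetter< : ∀ {c} → c < m → nextLetter m c < m
  nextLetter< {c} c<m = subst (_< m) (sym (nextLetter≡suc% c<m)) (m%n<n (suc c) m)

  advance≡+% : ∀ r {c} → c < m → advance m r c ≡ (c + r) % m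
  advance≡+% zero    {c} c<m = trans (sym (m<n⇒m%n≡m c<m)) (cong (_% m) (sym (+-identityʳ c)))
  advance≡+% (suc r) {c} c<m = begin
    advance m r (nextLetter m c) ≡⟨ advance≡+% r (nextLetter< c<m) ⟩
    (nextLetter m c + r) % m     ≡⟨ cong (λ d → (d + r) % m) (nextLetter≡suc% c<m) ⟩
    (suc c % m + r) % m          ≡⟨ %-distribˡ-+ (suc c % m) r m ⟩
    (suc c % m % m + r % m) % m  ≡⟨ cong (λ d → (d + r % m) % m) (m%n%n≡m%n (suc c) m) ⟩
    (suc c % m + r % m) % m      ≡⟨ %-distribˡ-+ (suc c) r m ⟨
    (suc c + r) % m              ≡⟨ cong (_% m) (+-suc c r) ⟨
    (c + suc r) % m              ∎
    where open ≡-Reasoning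

  advance< : ∀ r {c} → c < m → advance m r c < m
  advance< r {c} c<m = subst (_< m) (sym (advance≡+% r c<m)) (m%n<n (c + r) m)

  private
    +%≡-cancel : ∀ {c r} → c < m → r < m → (c + r) % m ≡ c → r ≡ 0
    +%≡-cancel {c} {r} c<m r<m eq with c + r <? m
    ... | yes c+r<m = +-cancelˡ-≡ c r 0 (trans (sym (m<n⇒m%n≡m c+r<m)) (trans eq (sym (+-identityʳ c))))
    ... | no  c+r≮m = contradiction (+-cancelˡ-≡ c r m c+r≡c+m) (<⇒≢ r<m)
      where
      m≤c+r = ≮⇒≥ c+r≮m
      wrapped : c + r ∸ m ≡ c
      wrapped = trans (sym (m<n⇒m%n≡m (m<n+o⇒m∸n<o (c + r) m (+-mono-< c<m r<m))))
                      (trans (m≤n⇒[n∸m]%m≡n%m m≤c+r) eq)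
      c+r≡c+m : c + r ≡ c + m
      c+r≡c+m = trans (sym (m∸n+n≡m m≤c+r)) (cong (_+ m) wrapped)

  advance≡⇔∣ : ∀ r {c} → c < m → advance m r c ≡ c ⇔ m ∣ r
  advance≡⇔∣ r {c} c<m = mk⇔ to from
    where
    from : m ∣ r → advance m r c ≡ c
    from m∣r = trans (advance≡+% r c<m) (trans (%-remove-+ʳ c m∣r) (m<n⇒m%n≡m c<m))
    to : advance m r c ≡ c → m ∣ r
    to eq = m%n≡0⇒n∣m r m (+%≡-cancel c<m (m%n<n r m) (begin
      (c + r % m) % m         ≡⟨ cong (λ d → (d + r % m) % m) (m<n⇒m%n≡m c<m) ⟨
      (c % m + r % m) % m     ≡⟨ %-distribˡ-+ c r m ⟨
      (c + r) % m             ≡⟨ advance≡+% r c<m ⟨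
      advance m r c           ≡⟨ eq ⟩
      c                       ∎))
      where open ≡-Reasoning

  advance-return⇒∣ : ∀ p t r → advance m r (advance m (p + t) 0) ≡ advance m p 0 → m ∣ t + r
  advance-return⇒∣ p t r eq = Equivalence.to (advance≡⇔∣ (t + r) (advance< p (>-nonZero⁻¹ m))) (begin
    advance m (t + r) (advance m p 0)          ≡⟨ advance-+ m t r _ ⟩
    advance m r (advance m t (advance m p 0))  ≡⟨ cong (advance m r) (advance-+ m p t 0) ⟨
    advance m r (advance m (p + t) 0)          ≡⟨ eq ⟩
    advance m p 0                              ∎)
    where open ≡-Reasoning

  advance-fixed : ∀ {r c} → c < m → r < m → advance m r c ≡ c → r ≡ 0
  advance-fixed {zero}  c<m r<m eq = refl
  advance-fixed {suc r} c<m r<m eq =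
    contradiction (∣⇒≤ (Equivalence.to (advance≡⇔∣ (suc r) c<m) eq)) (<⇒≱ r<m)

Congruent⇔∣ : ∀ {m n j} → j ≤ m → Congruent n (m ∸ j) m ⇔ m ∣ n + j
Congruent⇔∣ {m} {n} {j} j≤m = mk⇔
  (λ m∣d → ℤ.∣⇒∣ᵤ (subst (⁺ m ℤ.∣_) shift (ℤ.∣m∣n⇒∣m+n (ℤ.∣ᵤ⇒∣ {i = d} m∣d) ℤ.∣-refl)))
  (λ m∣n+j → ℤ.∣⇒∣ᵤ (ℤ.∣m+n∣n⇒∣m {m = d} (subst (⁺ m ℤ.∣_) (sym shift) (ℤ.∣ᵤ⇒∣ m∣n+j)) ℤ.∣-refl))
  where
  open ≡-Reasoning
  d = ⁺ n -ℤ ⁺ (m ∸ j)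
  shift : d +ℤ ⁺ m ≡ ⁺ (n + j)
  shift = begin
    ⁺ n -ℤ ⁺ (m ∸ j) +ℤ ⁺ m         ≡⟨ ℤ.+-assoc (⁺ n) (- ⁺ (m ∸ j)) (⁺ m) ⟩
    ⁺ n +ℤ (- ⁺ (m ∸ j) +ℤ ⁺ m)     ≡⟨ cong (⁺ n +ℤ_) (ℤ.+-comm (- ⁺ (m ∸ j)) (⁺ m)) ⟩
    ⁺ n +ℤ (⁺ m -ℤ ⁺ (m ∸ j))       ≡⟨ cong (⁺ n +ℤ_) (ℤ.[+m]-[+n]≡m⊖n m (m ∸ j)) ⟩
    ⁺ n +ℤ (m ⊖ (m ∸ j))          ≡⟨ cong (⁺ n +ℤ_) (ℤ.⊖-≥ (m∸n≤m m j)) ⟩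
    ⁺ n +ℤ ⁺ (m ∸ (m ∸ j))          ≡⟨ cong (λ i → ⁺ n +ℤ ⁺ i) (m∸[m∸n]≡n j≤m) ⟩
    ⁺ n +ℤ ⁺ j                      ≡⟨ ℤ.pos-+ n j ⟨
    ⁺ (n + j)                       ∎

-- Cyclic words and their runs

Positive : List ℕ → Set
Positive = All (1 ≤_)

cyclicRuns : ℕ → ℕ → List ℕ → List (List ℕ)
cyclicRuns m c []      = []
cyclicRuns m c (e ∷ α) = replicate e c ∷ cyclicRuns m (nextLetter m c) α

module _ {m : ℕ} where

  cyclicFrom-++ : ∀ c A B → cyclicFrom m c (A ++ B) ≡ cyclicFrom m c A ++ cyclicFrom m (advance m (length A) c) B
  cyclicFrom-++ c []      B = refl
  cyclicFrom-++ c (e ∷ A) B =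
    trans (cong (replicate e c ++_) (cyclicFrom-++ (nextLetter m c) A B))
          (sym (++-assoc (replicate e c) _ _))

  cyclicFrom-∷ʳ : ∀ c A e → cyclicFrom m c (A ∷ʳ e) ≡ cyclicFrom m c A ++ replicate e (advance m (length A) c)
  cyclicFrom-∷ʳ c A e = trans (cyclicFrom-++ c A [ e ]) (cong (cyclicFrom m c A ++_) (++-identityʳ _))

  length-cyclicFrom : ∀ c α → length (cyclicFrom m c α) ≡ sum α
  length-cyclicFrom c []      = refl
  length-cyclicFrom c (e ∷ α) =
    trans (length-++ (replicate e c)) (cong₂ _+_ (length-replicate e) (length-cyclicFrom (nextLetter m c) α))

  advance-∷ʳ : ∀ (A : List ℕ) e c → advance m (length (A ∷ʳ e)) c ≡ nextLetter m (advance m (length A) c)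
  advance-∷ʳ A e c = trans (cong (λ r → advance m r c) (trans (length-++ A) (+-comm (length A) 1)))
                           (advance-suc m (length A) c)

  -- The run a + b of w is cut into a final piece a of p and an initial piece b of q.
  record Cut (c : ℕ) (w p q : List ℕ) : Set where
    field
      before after : List ℕ
      a b : ℕ
      w≡ : w ≡ before ++ (a + b) ∷ after
      1≤a : 1 ≤ a
      p≡ : p ≡ cyclicFrom m c (before ∷ʳ a)
      q≡ : q ≡ cyclicFrom m (advance m (length before) c) (b ∷ after)

  -- Opaque: clients use only the specification, and unfolding the construction makes their types explode.
  opaque
    cut : ∀ c w p q → cyclicFrom m c w ≡ p ++ q → NonEmpty p → Cut c w p q
    cut c []      []      q eq p≢[] = contradiction refl p≢[]
    cut c (e ∷ w) p       q eq p≢[] with replicate-++-split e c (cyclicFrom m (nextLetter m c) w) p q eq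
    ... | inj₁ (zero  , b , _ , refl , _) = contradiction refl p≢[]
    ... | inj₁ (suc a , b , refl , refl , q≡) = record
      { before = [] ; after = w ; a = suc a ; b = b ; w≡ = refl ; 1≤a = s≤s z≤n
      ; p≡ = sym (++-identityʳ _) ; q≡ = q≡ }
    ... | inj₂ (p′ , p′≢[] , refl , rest≡) = record
      { before = e ∷ before ; after = after ; a = a ; b = b ; w≡ = cong (e ∷_) w≡ ; 1≤a = 1≤a
      ; p≡ = cong (replicate e c ++_) p≡ ; q≡ = q≡ }
      where open Cut (cut (nextLetter m c) w p′ q rest≡ p′≢[])

  record BoundaryCut (c : ℕ) (w p q : List ℕ) : Set where
    field
      w₁ w₂ : List ℕ
      w≡ : w ≡ w₁ ++ w₂
      p≡ : p ≡ cyclicFrom m c w₁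
      q≡ : q ≡ cyclicFrom m (advance m (length w₁) c) w₂

  private
    shift-run : ∀ (A : List ℕ) a B → A ++ (a + 0) ∷ B ≡ (A ∷ʳ a) ++ B
    shift-run A a B = trans (cong (λ n → A ++ n ∷ B) (+-identityʳ a)) (sym (++-assoc A [ a ] B))

  opaque
    cut-at-change : ∀ c w p x y q → cyclicFrom m c w ≡ (p ∷ʳ x) ++ (y ∷ q) → x ≢ y →
                    BoundaryCut c w (p ∷ʳ x) (y ∷ q)
    cut-at-change c w p x y q eq x≢y with cut c w (p ∷ʳ x) (y ∷ q) eq (∷ʳ-nonEmpty p x)
    ... | record { before = before ; a = a ; b = suc b ; 1≤a = 1≤a ; p≡ = p≡ ; q≡ = q≡ } =
      contradiction (trans (last-replicate p _ x a _ 1≤a (trans p≡ (cyclicFrom-∷ʳ c before a)))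
                           (sym (proj₁ (∷-injective q≡)))) x≢y
    ... | record { before = before ; after = after ; a = a ; b = zero ; w≡ = w≡ ; p≡ = p≡ ; q≡ = q≡ } = record
      { w₁ = before ∷ʳ a ; w₂ = after ; w≡ = trans w≡ (shift-run before a after) ; p≡ = p≡
      ; q≡ = trans q≡ (cong (λ d → cyclicFrom m d after) (sym (advance-∷ʳ before a c))) }

  record SuffixCut (c : ℕ) (w X : List ℕ) : Set where
    field
      P R : List ℕ
      a b : ℕ
      w≡ : w ≡ P ++ (a + b) ∷ R
      1≤b : 1 ≤ b
      X≡ : X ≡ cyclicFrom m (advance m (length P) c) (b ∷ R)

  opaque
    cut-suffix : ∀ c w p X → Positive w → NonEmpty X → cyclicFrom m c w ≡ p ++ X → SuffixCut c w X
    cut-suffix c []      [] X _           X≢[] eq = contradiction (sym eq) X≢[]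
    cut-suffix c (e ∷ R) [] X (1≤e ∷ _) _    eq =
      record { P = [] ; R = R ; a = 0 ; b = e ; w≡ = refl ; 1≤b = 1≤e ; X≡ = sym eq }
    cut-suffix c w (x ∷ p) X pos X≢[] eq with cut c w (x ∷ p) X eq (λ ())
    ... | record { before = before ; after = after ; a = a ; b = suc b ; w≡ = w≡ ; q≡ = q≡ } =
      record { P = before ; R = after ; a = a ; b = suc b ; w≡ = w≡ ; 1≤b = s≤s z≤n ; X≡ = q≡ }
    ... | record { after = [] ; b = zero ; q≡ = q≡ } = contradiction q≡ X≢[]
    ... | record { before = before ; after = e ∷ R ; a = a ; b = zero ; w≡ = w≡ ; q≡ = q≡ } = record
      { P = before ∷ʳ a ; R = R ; a = 0 ; b = e ; w≡ = trans w≡ (shift-run before a (e ∷ R)) ; 1≤b = 1≤e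
      ; X≡ = trans q≡ (cong (λ d → cyclicFrom m d (e ∷ R)) (sym (advance-∷ʳ before a c))) }
      where
      1≤e : 1 ≤ e
      1≤e = All.head (All.tail (Allₚ.++⁻ʳ before (subst Positive w≡ pos)))

  concat-cyclicRuns : ∀ c α → concat (cyclicRuns m c α) ≡ cyclicFrom m c α
  concat-cyclicRuns c []      = refl
  concat-cyclicRuns c (e ∷ α) = cong (replicate e c ++_) (concat-cyclicRuns (nextLetter m c) α)

  length-cyclicRuns : ∀ c α → length (cyclicRuns m c α) ≡ length α
  length-cyclicRuns c []      = refl
  length-cyclicRuns c (e ∷ α) = cong suc (length-cyclicRuns (nextLetter m c) α)

  cyclicRuns-runs : ∀ c α → Positive α → All Run (cyclicRuns m c α)
  cyclicRuns-runs c []          []          = []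
  cyclicRuns-runs c (suc e ∷ α) (_ ∷ pos)   = (e , c , refl) ∷ cyclicRuns-runs (nextLetter m c) α pos

  cyclicFrom-shrink-first : ∀ {a a′} c L → a′ ≤ a →
    cyclicFrom m c (a ∷ L) ≡ replicate (a ∸ a′) c ++ cyclicFrom m c (a′ ∷ L)
  cyclicFrom-shrink-first {a} {a′} c L a′≤a = begin
    replicate a c ++ cyclicFrom m (nextLetter m c) L
      ≡⟨ cong (λ n → replicate n c ++ cyclicFrom m (nextLetter m c) L) (m∸n+n≡m a′≤a) ⟨
    replicate (a ∸ a′ + a′) c ++ cyclicFrom m (nextLetter m c) L
      ≡⟨ cong (_++ cyclicFrom m (nextLetter m c) L) (replicate-+ (a ∸ a′) a′ c) ⟩
    (replicate (a ∸ a′) c ++ replicate a′ c) ++ cyclicFrom m (nextLetter m c) L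
      ≡⟨ ++-assoc (replicate (a ∸ a′) c) _ _ ⟩
    replicate (a ∸ a′) c ++ replicate a′ c ++ cyclicFrom m (nextLetter m c) L ∎
    where open ≡-Reasoning

  cyclicFrom-grow-last : ∀ {e e′} c L → e ≤ e′ →
    cyclicFrom m c (L ∷ʳ e′) ≡ cyclicFrom m c (L ∷ʳ e) ++ replicate (e′ ∸ e) (advance m (length L) c)
  cyclicFrom-grow-last {e} {e′} c L e≤e′ = begin
    cyclicFrom m c (L ∷ʳ e′)
      ≡⟨ cyclicFrom-∷ʳ c L e′ ⟩
    cyclicFrom m c L ++ replicate e′ d
      ≡⟨ cong (λ n → cyclicFrom m c L ++ replicate n d) (m+[n∸m]≡n e≤e′) ⟨
    cyclicFrom m c L ++ replicate (e + (e′ ∸ e)) d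
      ≡⟨ cong (cyclicFrom m c L ++_) (replicate-+ e (e′ ∸ e) d) ⟩
    cyclicFrom m c L ++ replicate e d ++ replicate (e′ ∸ e) d
      ≡⟨ ++-assoc (cyclicFrom m c L) _ _ ⟨
    (cyclicFrom m c L ++ replicate e d) ++ replicate (e′ ∸ e) d
      ≡⟨ cong (_++ replicate (e′ ∸ e) d) (cyclicFrom-∷ʳ c L e) ⟨
    cyclicFrom m c (L ∷ʳ e) ++ replicate (e′ ∸ e) d ∎
    where
    open ≡-Reasoning
    d = advance m (length L) c

  frame-factor : ∀ {a a′ e e′} c mid α → a′ ≤ a → e ≤ e′ →
    advance m (length α) (advance m (length (a ∷ mid ∷ʳ e)) c) ≡ c →
    Factor (cyclicFrom m c (a′ ∷ mid ∷ʳ e) ++ cyclicFrom m (advance m (length (a ∷ mid ∷ʳ e)) c) α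
                                          ++ cyclicFrom m c (a′ ∷ mid ∷ʳ e))
           (cyclicFrom m c ((a ∷ mid ∷ʳ e) ++ α ++ (a′ ∷ mid ∷ʳ e′)))
  frame-factor {a} {a′} {e} {e′} c mid α a′≤a e≤e′ returns = replicate (a ∸ a′) c , replicate (e′ ∸ e) d , (begin
    cyclicFrom m c (B₁ ++ α ++ B₂)
      ≡⟨ cyclicFrom-++ c B₁ (α ++ B₂) ⟩
    cyclicFrom m c B₁ ++ cyclicFrom m c₁ (α ++ B₂)
      ≡⟨ cong (cyclicFrom m c B₁ ++_) (cyclicFrom-++ c₁ α B₂) ⟩
    cyclicFrom m c B₁ ++ Y ++ cyclicFrom m (advance m (length α) c₁) B₂
      ≡⟨ cong (λ c′ → cyclicFrom m c B₁ ++ Y ++ cyclicFrom m c′ B₂) returns ⟩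
    cyclicFrom m c B₁ ++ Y ++ cyclicFrom m c B₂
      ≡⟨ cong₂ (λ U V → U ++ Y ++ V) (cyclicFrom-shrink-first c (mid ∷ʳ e) a′≤a)
                                     (cyclicFrom-grow-last c (a′ ∷ mid) e≤e′) ⟩
    (replicate (a ∸ a′) c ++ X) ++ Y ++ X ++ replicate (e′ ∸ e) d
      ≡⟨ ++-assoc (replicate (a ∸ a′) c) X _ ⟩
    replicate (a ∸ a′) c ++ X ++ Y ++ X ++ replicate (e′ ∸ e) d
      ≡⟨ cong (λ V → replicate (a ∸ a′) c ++ X ++ V) (++-assoc Y X _) ⟨
    replicate (a ∸ a′) c ++ X ++ (Y ++ X) ++ replicate (e′ ∸ e) d
      ≡⟨ cong (replicate (a ∸ a′) c ++_) (++-assoc X (Y ++ X) _) ⟨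
    replicate (a ∸ a′) c ++ (X ++ Y ++ X) ++ replicate (e′ ∸ e) d ∎)
    where
    open ≡-Reasoning
    B₁ = a ∷ mid ∷ʳ e
    B₂ = a′ ∷ mid ∷ʳ e′
    c₁ = advance m (length B₁) c
    d = advance m (suc (length mid)) c
    X = cyclicFrom m c (a′ ∷ mid ∷ʳ e)
    Y = cyclicFrom m c₁ α

-- Walks through consecutive letters

Step : ℕ → ℕ → ℕ → Set
Step m a b = a < m × (b ≡ a ⊎ b ≡ nextLetter m a)

module _ {m : ℕ} .{{_ : NonZero m}} (2<m : 2 < m) where

  nextLetter≢ : ∀ {c} → c < m → nextLetter m c ≢ c
  nextLetter≢ c<m eq with () ← advance-fixed c<m (<-trans (s≤s (s≤s z≤n)) 2<m) eq

  head-cyclicFrom-next : ∀ {c} L → c < m → Positive L → head (cyclicFrom m (nextLetter m c) L) ≢ just c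
  head-cyclicFrom-next []          c<m _ ()
  head-cyclicFrom-next (zero ∷ L)  c<m (() ∷ _)
  head-cyclicFrom-next (suc e ∷ L) c<m _ eq = nextLetter≢ c<m (just-injective eq)

  cyclicFrom-injectiveʳ : ∀ {c} L L′ → c < m → Positive L → Positive L′ →
                          cyclicFrom m c L ≡ cyclicFrom m c L′ → L ≡ L′
  cyclicFrom-injectiveʳ []          []           _   _ _ _ = refl
  cyclicFrom-injectiveʳ []          (suc e′ ∷ _) _   _ _ ()
  cyclicFrom-injectiveʳ (suc e ∷ _) []           _   _ _ ()
  cyclicFrom-injectiveʳ (zero ∷ _)  _            _   (() ∷ _) _ _
  cyclicFrom-injectiveʳ _           (zero ∷ _)   _   _ (() ∷ _) _
  cyclicFrom-injectiveʳ {c} (suc e ∷ L) (suc e′ ∷ L′) c<m (_ ∷ pos) (_ ∷ pos′) eq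
    with refl , eq′ ← replicate-++-injective (suc e) (suc e′)
           (head-cyclicFrom-next L c<m pos) (head-cyclicFrom-next L′ c<m pos′) eq
    = cong (suc e ∷_) (cyclicFrom-injectiveʳ L L′ (nextLetter< c<m) pos pos′ eq′)

  cyclicFrom-injective : ∀ {c c′} L L′ → c < m → Positive L → Positive L′ → NonEmpty L →
                         cyclicFrom m c L ≡ cyclicFrom m c′ L′ → c ≡ c′ × L ≡ L′
  cyclicFrom-injective []          _            _   _   _ L≢[] _  = contradiction refl L≢[]
  cyclicFrom-injective (suc e ∷ L) []           _   _   _ _    ()
  cyclicFrom-injective (zero ∷ L)  _            _   (() ∷ _) _ _ _
  cyclicFrom-injective _           (zero ∷ L′)  _   _ (() ∷ _) _ _
  cyclicFrom-injective (suc e ∷ L) (suc e′ ∷ L′) c<m pos pos′ _ eq with refl ← proj₁ (∷-injective eq)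
    = refl , cyclicFrom-injectiveʳ (suc e ∷ L) (suc e′ ∷ L′) c<m pos pos′ eq

  run-bound : ∀ {K c L x} w p q → c < m → Positive w → All (_≤ K) w →
              cyclicFrom m c w ≡ p ++ replicate L x ++ q → L ≤ K
  run-bound {L = zero}          w p q _   _   _   _  = z≤n
  run-bound {K} {c} {suc L} {x} w p q c<m pos ≤K eq = ≤-trans (+-mono-≤ 1≤a L≤b) a+b≤K
    where
    open Cut (cut c w (p ∷ʳ x) (replicate L x ++ q) (trans eq (sym (++-assoc p [ x ] _))) (∷ʳ-nonEmpty p x))
    c′ = advance m (length before) c
    x≡c′ : x ≡ c′
    x≡c′ = last-replicate p _ x a c′ 1≤a (trans p≡ (cyclicFrom-∷ʳ c before a))
    after-pos : Positive ((a + b) ∷ after)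
    after-pos = Allₚ.++⁻ʳ before (subst Positive w≡ pos)
    L≤b : L ≤ b
    L≤b = replicate-++-≤ L b (head-cyclicFrom-next after (advance< (length before) c<m) (Allₚ.++⁻ʳ [ a + b ] after-pos))
            (trans (cong (λ d → replicate L d ++ q) (sym x≡c′)) q≡)
    a+b≤K : a + b ≤ K
    a+b≤K = All.head (Allₚ.++⁻ʳ before (subst (All (_≤ K)) w≡ ≤K))

  cyclicFrom-walk : ∀ {c} w → c < m → Positive w → Linked (Step m) (cyclicFrom m c w)
  cyclicFrom-walk []          _   _         = []
  cyclicFrom-walk (zero ∷ w)  _   (() ∷ _)
  cyclicFrom-walk {c} (suc e ∷ w) c<m (_ ∷ pos) =
    run e (enter w pos) (cyclicFrom-walk w (nextLetter< c<m) pos)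
    where
    enter : ∀ w → Positive w → Connected (Step m) (just c) (head (cyclicFrom m (nextLetter m c) w))
    enter []          _        = just-nothing
    enter (zero ∷ _)  (() ∷ _)
    enter (suc _ ∷ _) _        = just (c<m , inj₂ refl)
    run : ∀ e {r} → Connected (Step m) (just c) (head r) → Linked (Step m) r → Linked (Step m) (c ∷ replicate e c ++ r)
    run zero    enters walk = enters ∷′ walk
    run (suc e) enters walk = (c<m , inj₁ refl) ∷ run e enters walk

  walk-reverse-changes : ∀ l → Linked (Step m) l → Linked (Step m) (reverse l) → changes l ≡ 0
  walk-reverse-changes []          _ _ = refl
  walk-reverse-changes (a ∷ [])    _ _ = refl
  walk-reverse-changes (a ∷ b ∷ l) ((a<m , step) ∷ walk) walkᴿ with a ≟ b
  ... | yes refl = walk-reverse-changes (a ∷ l) walk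
        (Linked-++⁻ˡ (reverse (a ∷ l)) [ a ] (subst (Linked (Step m)) (unfold-reverse a (a ∷ l)) walkᴿ))
  ... | no a≢b with step
  ...   | inj₁ refl = contradiction refl a≢b
  ...   | inj₂ refl with Linked-++⁻ʳ (reverse l) _ (subst (Linked (Step m)) (reverse-++ (a ∷ b ∷ []) l) walkᴿ)
  ...     | (_ , inj₁ a≡b) ∷ _ = contradiction a≡b a≢b
  ...     | (_ , inj₂ a≡b′) ∷ _ with () ← advance-fixed {r = 2} a<m 2<m (sym a≡b′)

  lastOf-walk : ∀ a l → Linked (Step m) (a ∷ l) → lastOf a l ≡ advance m (changesFrom a l) a
  lastOf-walk a []      _                      = refl
  lastOf-walk a (b ∷ l) ((a<m , step) ∷ walk) with a ≟ b
  ... | yes refl = lastOf-walk a l walk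
  ... | no a≢b with step
  ...   | inj₁ refl = contradiction refl a≢b
  ...   | inj₂ refl = lastOf-walk (nextLetter m a) l walk

  closed-walk-constant : ∀ a l → Linked (Step m) (a ∷ l) → lastOf a l ≡ a → changesFrom a l < m →
                         l ≡ replicate (length l) a
  closed-walk-constant a []      _    _      _   = refl
  closed-walk-constant a (b ∷ l) walk closed few =
    changesFrom≡0 a (b ∷ l)
      (advance-fixed (proj₁ (Linked.head walk)) few (trans (sym (lastOf-walk a (b ∷ l) walk)) closed))

  changesFrom-cyclicFrom-next : ∀ {c} α → c < m → Positive α →
                                changesFrom c (cyclicFrom m (nextLetter m c) α) ≡ length α
  changesFrom-cyclicFrom-next []          _   _        = refl
  changesFrom-cyclicFrom-next (zero ∷ α)  _   (() ∷ _)
  changesFrom-cyclicFrom-next {c} (suc e ∷ α) c<m (_ ∷ pos) with c ≟ nextLetter m c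
  ... | yes c≡c′ = contradiction (sym c≡c′) (nextLetter≢ c<m)
  ... | no  _    = cong suc (trans (changesFrom-replicate-++ (nextLetter m c) e _)
                                   (changesFrom-cyclicFrom-next α (nextLetter< c<m) pos))

  changes-cyclicFrom : ∀ {c} e α → c < m → Positive α → changes (cyclicFrom m c (suc e ∷ α)) ≡ length α
  changes-cyclicFrom {c} e α c<m pos =
    trans (changesFrom-replicate-++ c e _) (changesFrom-cyclicFrom-next α c<m pos)

toList-∷ʳ : ∀ {A : Set} {n} (v : Vec A n) x → toList (v ∷ʳᵥ x) ≡ toList v ∷ʳ x
toList-∷ʳ []ᵥ       x = refl
toList-∷ʳ (y ∷ᵥ v) x = cong (y ∷_) (toList-∷ʳ v x)

sum-toList : ∀ {n} (v : Vec ℕ n) → sum (toList v) ≡ Vec.sum v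
sum-toList []ᵥ       = refl
sum-toList (x ∷ᵥ v) = cong (x +_) (sum-toList v)

LastGrows : ∀ {n} → Vec ℕ n → Vec ℕ n → Set
LastGrows {n} t t′ = (i : Fin n) →
    (suc (toℕ i) ≡ n → lookup t i ≤ lookup t′ i)
  × (suc (toℕ i) < n → lookup t i ≡ lookup t′ i)

LastGrows-∷ʳ : ∀ {n} (v : Vec ℕ n) {e e′} → e ≤ e′ → LastGrows (v ∷ʳᵥ e) (v ∷ʳᵥ e′)
LastGrows-∷ʳ []ᵥ      e≤e′ fzero    = (λ _ → e≤e′) , λ { (s≤s ()) }
LastGrows-∷ʳ (x ∷ᵥ v) e≤e′ fzero    = (λ ()) , (λ _ → refl)
LastGrows-∷ʳ (x ∷ᵥ v) e≤e′ (fsuc i) with last , middle ← LastGrows-∷ʳ v e≤e′ i =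
  (λ eq → last (suc-injective eq)) , (λ lt → middle (s<s⁻¹ lt))

LastGrows⁻ : ∀ {n} (t t′ : Vec ℕ (suc n)) → LastGrows t t′ →
             Σ (Vec ℕ n) λ v → ∃₂ λ e e′ → t ≡ v ∷ʳᵥ e × t′ ≡ v ∷ʳᵥ e′ × e ≤ e′
LastGrows⁻ {zero}  (e ∷ᵥ []ᵥ) (e′ ∷ᵥ []ᵥ) grows = []ᵥ , e , e′ , refl , refl , proj₁ (grows fzero) refl
LastGrows⁻ {suc n} (x ∷ᵥ t)   (y ∷ᵥ t′)   grows
  with refl ← proj₂ (grows fzero) (s≤s (s≤s z≤n))
  with v , e , e′ , refl , refl , e≤e′ ← LastGrows⁻ t t′ (λ i →
         (λ eq → proj₁ (grows (fsuc i)) (cong suc eq)) , (λ lt → proj₂ (grows (fsuc i)) (s<s lt)))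
  = x ∷ᵥ v , e , e′ , refl , refl , e≤e′

EndCond-∷ : ∀ {n a a′} {t t′ : Vec ℕ (suc n)} → a′ ≤ a → LastGrows t t′ →
            EndCond (a ∷ᵥ t) (a′ ∷ᵥ t′)
EndCond-∷ a′≤a grows fzero    = (λ _ → a′≤a) , (λ ()) , (λ ())
EndCond-∷ a′≤a grows (fsuc i) =
  (λ ()) , (λ eq → proj₁ (grows i) (suc-injective eq)) , (λ _ lt → proj₂ (grows i) (s<s⁻¹ lt))

EndCond-∷⁻ : ∀ {n a a′} {t t′ : Vec ℕ n} → EndCond (a ∷ᵥ t) (a′ ∷ᵥ t′) → a′ ≤ a × LastGrows t t′
EndCond-∷⁻ ends = proj₁ (ends fzero) refl , λ i →
    (λ eq → proj₁ (proj₂ (ends (fsuc i))) (cong suc eq))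
  , (λ lt → proj₂ (proj₂ (ends (fsuc i))) (s≤s z≤n) (s<s lt))

-- BadFactor with x′ = a mid e and x″ = a′ mid e′ written out as lists.
record Frame (k m j : ℕ) (w : List ℕ) : Set where
  field
    P mid α S : List ℕ
    a a′ e e′ : ℕ
    w≡ : w ≡ P ++ ((a ∷ mid ∷ʳ e) ++ α ++ (a′ ∷ mid ∷ʳ e′)) ++ S
    a′≤a : a′ ≤ a
    e≤e′ : e ≤ e′
    length-α : length α ≡ j
    k≤sum : k ≤ sum α
    period : m ∣ suc (suc (length mid)) + j

frame⇒badFactor : ∀ {k m j w} → All (λ a → 1 ≤ a × a ≤ suc k) w → j ≤ m → Frame k m j w → BadFactor k m j w
frame⇒badFactor {k} letters j≤m
  record { P = P ; mid = mid ; α = α ; S = S ; a = a ; a′ = a′ ; e = e ; e′ = e′ ; w≡ = refl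
         ; a′≤a = a′≤a ; e≤e′ = e≤e′ ; length-α = refl ; k≤sum = k≤sum ; period = period }
  = suc (suc (length mid)) , a ∷ᵥ (fromList mid ∷ʳᵥ e) , fromList α , a′ ∷ᵥ (fromList mid ∷ʳᵥ e′)
  , (P , S , cong (λ v → P ++ v ++ S) (sym factor≡))
  , subst (All _) (sym (toList∘fromList α))
      (Allₚ.++⁻ˡ α (Allₚ.++⁻ʳ (a ∷ mid ∷ʳ e) (Allₚ.++⁻ˡ _ (Allₚ.++⁻ʳ P letters))))
  , subst (k ≤_) (trans (cong sum (sym (toList∘fromList α))) (sum-toList (fromList α))) k≤sum
  , Equivalence.from (Congruent⇔∣ j≤m) period
  , EndCond-∷ a′≤a (LastGrows-∷ʳ (fromList mid) e≤e′)
  where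
  toList-frame : ∀ x y → toList (x ∷ᵥ (fromList mid ∷ʳᵥ y)) ≡ x ∷ mid ∷ʳ y
  toList-frame x y = cong (x ∷_) (trans (toList-∷ʳ (fromList mid) y) (cong (_∷ʳ y) (toList∘fromList mid)))
  factor≡ : toList (a ∷ᵥ (fromList mid ∷ʳᵥ e)) ++ toList (fromList α) ++ toList (a′ ∷ᵥ (fromList mid ∷ʳᵥ e′))
          ≡ (a ∷ mid ∷ʳ e) ++ α ++ (a′ ∷ mid ∷ʳ e′)
  factor≡ = cong₂ _++_ (toList-frame a e) (cong₂ _++_ (toList∘fromList α) (toList-frame a′ e′))

badFactor⇒frame : ∀ {k m j w} → 1 ≤ j → suc (suc j) ≤ m → BadFactor k m j w → Frame k m j w
badFactor⇒frame {k} {m} {j} {w} 1≤j j+2≤m (n , x′ , α , x″ , factor , _ , k≤Σ , congruent , ends) =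
  frame x′ x″ factor 2≤n m∣n+j ends
  where
  m∣n+j : m ∣ n + j
  m∣n+j = Equivalence.to (Congruent⇔∣ (≤-trans (n≤1+n j) (≤-trans (n≤1+n (suc j)) j+2≤m))) congruent
  2≤n : 2 ≤ n
  2≤n = +-cancelʳ-≤ j 2 n (≤-trans j+2≤m (∣⇒≤ {{>-nonZero (≤-trans 1≤j (m≤n+m j n))}} m∣n+j))
  frame : ∀ {n} (x′ x″ : Vec ℕ n) → Factor (toList x′ ++ toList α ++ toList x″) w → 2 ≤ n → m ∣ n + j →
          EndCond x′ x″ → Frame k m j w
  frame (a ∷ᵥ t) (a′ ∷ᵥ t′) (P , S , w≡) (s≤s (s≤s _)) period ends
    with a′≤a , grows ← EndCond-∷⁻ ends
    with v , e , e′ , refl , refl , e≤e′ ← LastGrows⁻ t t′ grows = record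
    { P = P ; mid = toList v ; α = toList α ; S = S ; a = a ; a′ = a′ ; e = e ; e′ = e′
    ; w≡ = trans w≡ (cong₂ (λ x′ x″ → P ++ (a ∷ x′ ++ toList α ++ a′ ∷ x″) ++ S)
                           (toList-∷ʳ v e) (toList-∷ʳ v e′))
    ; a′≤a = a′≤a ; e≤e′ = e≤e′ ; length-α = length-toList α
    ; k≤sum = subst (k ≤_) (sym (sum-toList α)) k≤Σ
    ; period = subst (λ l → m ∣ suc (suc l) + j) (sym (length-toList v)) period }

record PhiOccurrence (k : ℕ) (u : List ℕ) : Set where
  field
    X : List ℕ
    G : Fin k → List ℕ
    X≢[] : NonEmpty X
    G≢[] : ∀ i → NonEmpty (G i)
    XGX : Factor (X ++ concat (tabulate G) ++ X) u
    mirrored : ∀ i → Factor (reverse (G i)) u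

image-phi-head : ∀ {A : Set} k (h : Fin (suc k) → List A) →
  image h ((inj₁ fzero ∷ map (inj₁ ∘ fsuc) (allFin k)) ++ [ inj₁ fzero ])
  ≡ h fzero ++ concat (tabulate (h ∘ fsuc)) ++ h fzero
image-phi-head k h = begin
  image h ((inj₁ fzero ∷ map (inj₁ ∘ fsuc) (allFin k)) ++ [ inj₁ fzero ])
    ≡⟨ concatMap-++ (extend h) (inj₁ fzero ∷ map (inj₁ ∘ fsuc) (allFin k)) [ inj₁ fzero ] ⟩
  concatMap (extend h) (inj₁ fzero ∷ map (inj₁ ∘ fsuc) (allFin k)) ++ (h fzero ++ [])
    ≡⟨ cong₂ (λ Y X → (h fzero ++ Y) ++ X) middle (++-identityʳ (h fzero)) ⟩
  (h fzero ++ concat (tabulate (h ∘ fsuc))) ++ h fzero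
    ≡⟨ ++-assoc (h fzero) _ _ ⟩
  h fzero ++ concat (tabulate (h ∘ fsuc)) ++ h fzero ∎
  where
  open ≡-Reasoning
  middle : concatMap (extend h) (map (inj₁ ∘ fsuc) (allFin k)) ≡ concat (tabulate (h ∘ fsuc))
  middle = trans (concatMap-map (extend h) (inj₁ ∘ fsuc) (allFin k)) (cong concat (map-tabulate (λ i → i) (h ∘ fsuc)))

occurs⇒phiOccurrence : ∀ {k u} → Occurs (phi k) u → PhiOccurrence k u
occurs⇒phiOccurrence {k} {u} (h , h≢[] , first ∷ mirrors) = record
  { X = h fzero ; G = h ∘ fsuc ; X≢[] = h≢[] fzero ; G≢[] = h≢[] ∘ fsuc
  ; XGX = subst (λ v → Factor v u) (image-phi-head k h) first
  ; mirrored = λ i → subst (λ v → Factor v u) (++-identityʳ _) (Allₚ.tabulate⁻ (Allₚ.map⁻ mirrors) i) }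

phiOccurrence⇒occurs : ∀ {k u} → PhiOccurrence k u → Occurs (phi k) u
phiOccurrence⇒occurs {k} {u} occ = h , h≢[] , first ∷ Allₚ.map⁺ (Allₚ.tabulate⁺ mirror)
  where
  open PhiOccurrence occ
  h : Fin (suc k) → List ℕ
  h fzero    = X
  h (fsuc i) = G i
  h≢[] : ∀ i → NonEmpty (h i)
  h≢[] fzero    = X≢[]
  h≢[] (fsuc i) = G≢[] i
  first : Factor (image h ((inj₁ fzero ∷ map (inj₁ ∘ fsuc) (allFin k)) ++ [ inj₁ fzero ])) u
  first = subst (λ v → Factor v u) (sym (image-phi-head k h)) XGX
  mirror : ∀ i → Factor (image h [ inj₂ (fsuc i) ]) u
  mirror i = subst (λ v → Factor v u) (sym (++-identityʳ _)) (mirrored i)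

-- From an occurrence to a bad factor

frame-of-runs : ∀ {k m} .{{_ : NonZero m}} {w} P R α v₁ v₂ a b a′ b′ → suc (suc k) ≤ m →
  w ≡ (P ++ (a + b) ∷ R) ++ α ++ (v₁ ++ (a′ + b′) ∷ v₂) → b ∷ R ≡ v₁ ∷ʳ a′ →
  m ∣ suc (length R) + length α → length α ≤ k → k ≤ sum α → Frame k m (length α) w
frame-of-runs P [] α v₁ v₂ a b a′ b′ k+2≤m w≡ bR period |α|≤k k≤Σ =
  ⊥-elim (<⇒≱ (≤-trans (s≤s (s≤s |α|≤k)) k+2≤m) (∣⇒≤ period))
frame-of-runs {k} {m} {w} P (r ∷ R) α v₁ v₂ a b a′ b′ k+2≤m w≡ bR period |α|≤k k≤Σ
  with mid , R≡ ← ∷-lastOf r R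
  with refl , refl ← ∷ʳ-injective (b ∷ mid) v₁ (trans (cong (b ∷_) (sym R≡)) bR) = record
  { P = P ; mid = mid ; α = α ; S = v₂ ; a = a + b ; a′ = b ; e = lastOf r R ; e′ = lastOf r R + b′
  ; w≡ = trans w≡ shape ; a′≤a = m≤n+m b a ; e≤e′ = m≤m+n _ b′ ; length-α = refl ; k≤sum = k≤Σ
  ; period = subst (λ l → m ∣ suc l + length α) (trans (cong length R≡) (length-∷ʳ mid _)) period }
  where
  eN = lastOf r R
  open ≡-Reasoning
  shape : (P ++ (a + b) ∷ r ∷ R) ++ α ++ ((b ∷ mid) ++ (eN + b′) ∷ v₂)
        ≡ P ++ (((a + b) ∷ mid ∷ʳ eN) ++ α ++ (b ∷ mid ∷ʳ (eN + b′))) ++ v₂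
  shape = begin
    (P ++ (a + b) ∷ r ∷ R) ++ α ++ ((b ∷ mid) ++ (eN + b′) ∷ v₂)
      ≡⟨ cong (λ T → (P ++ (a + b) ∷ T) ++ α ++ (b ∷ mid ++ (eN + b′) ∷ v₂)) R≡ ⟩
    (P ++ (a + b) ∷ mid ∷ʳ eN) ++ α ++ (b ∷ mid ++ [ eN + b′ ] ++ v₂)
      ≡⟨ cong (λ T → (P ++ (a + b) ∷ mid ∷ʳ eN) ++ α ++ (b ∷ T)) (++-assoc mid [ eN + b′ ] v₂) ⟨
    (P ++ (a + b) ∷ mid ∷ʳ eN) ++ α ++ (b ∷ mid ∷ʳ (eN + b′)) ++ v₂
      ≡⟨ ++-assoc P _ _ ⟩
    P ++ ((a + b) ∷ mid ∷ʳ eN) ++ α ++ (b ∷ mid ∷ʳ (eN + b′)) ++ v₂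
      ≡⟨ cong (λ Z → P ++ (a + b) ∷ (mid ∷ʳ eN) ++ Z) (++-assoc α _ v₂) ⟨
    P ++ ((a + b) ∷ mid ∷ʳ eN) ++ (α ++ (b ∷ mid ∷ʳ (eN + b′))) ++ v₂
      ≡⟨ cong (P ++_) (++-assoc ((a + b) ∷ mid ∷ʳ eN) _ v₂) ⟨
    P ++ (((a + b) ∷ mid ∷ʳ eN) ++ α ++ (b ∷ mid ∷ʳ (eN + b′))) ++ v₂ ∎

slide-left : ∀ (p X₀ Y s : List ℕ) y →
  p ++ (X₀ ∷ʳ y) ++ (y ∷ Y) ++ (X₀ ∷ʳ y) ++ s ≡ p ++ X₀ ++ (y ∷ y ∷ Y) ++ X₀ ++ (y ∷ s)
slide-left p X₀ Y s y =
  cong (p ++_) (trans (++-assoc X₀ [ y ] _) (cong (λ T → X₀ ++ y ∷ y ∷ Y ++ T) (++-assoc X₀ [ y ] s)))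

slide-right : ∀ (p X Y s : List ℕ) x →
  p ++ (x ∷ X) ++ Y ++ (x ∷ X) ++ s ≡ (p ∷ʳ x) ++ X ++ (Y ∷ʳ x) ++ X ++ s
slide-right p X Y s x =
  sym (trans (++-assoc p [ x ] _) (cong (λ T → p ++ x ∷ X ++ T) (++-assoc Y [ x ] _)))

module _ {k m : ℕ} .{{_ : NonZero m}} (k+2≤m : suc (suc k) ≤ m) (1≤k : 1 ≤ k)
         {w : List ℕ} (pos : Positive w) (≤k+1 : All (_≤ suc k) w) where

  private
    u : List ℕ
    u = cyclicFrom m 0 w
    0<m : 0 < m
    0<m = ≤-trans (s≤s z≤n) k+2≤m
    2<m : 2 < m
    2<m = ≤-trans (s≤s (s≤s 1≤k)) k+2≤m
    walk-u : Linked (Step m) u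
    walk-u = cyclicFrom-walk 2<m w 0<m pos

  -- The walk x Z x would close after at most k + 1 < m changes of letter, so it would be a run of
  -- length |Z| + 2 > k + 1.
  no-return : ∀ x Z → Factor (x ∷ Z ∷ʳ x) u → changes Z < k → k ≤ length Z → ⊥
  no-return x Z (p , s , u≡) few long = <⇒≱ (s≤s (s≤s long)) (begin
    suc (suc (length Z))         ≡⟨ cong suc (length-∷ʳ Z x) ⟨
    suc (length (Z ∷ʳ x))        ≤⟨ run-bound 2<m w p s 0<m pos ≤k+1 (trans u≡ (cong (λ v → p ++ v ++ s) constant)) ⟩
    suc k                        ∎)
    where
    open ≤-Reasoning
    few-changes : changesFrom x (Z ∷ʳ x) < m
    few-changes = begin-strict
      changesFrom x (Z ∷ʳ x)     ≤⟨ changesFrom-≤ x (Z ∷ʳ x) ⟩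
      suc (changes (Z ∷ʳ x))     ≤⟨ s≤s (changes-++ Z [ x ]) ⟩
      suc (changes Z + 1)        ≡⟨ cong suc (+-comm (changes Z) 1) ⟩
      suc (suc (changes Z))      ≤⟨ s≤s few ⟩
      suc k                      <⟨ k+2≤m ⟩
      m                          ∎
    constant : x ∷ Z ∷ʳ x ≡ replicate (suc (length (Z ∷ʳ x))) x
    constant = cong (x ∷_) (closed-walk-constant 2<m x (Z ∷ʳ x)
                 (Linked-factor (p , s , u≡) walk-u) (lastOf-∷ʳ x Z x) few-changes)

  record GappedRepeat : Set where
    field
      p s : List ℕ
      x y : ℕ
      X Y : List ℕ
      u≡ : u ≡ p ++ (x ∷ X) ++ (y ∷ Y) ++ (x ∷ X) ++ s
      few : changes (y ∷ Y) < k
      long : k ≤ length (y ∷ Y)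

  Aligned : GappedRepeat → Set
  Aligned g = lastOf x X ≢ y × lastOf y Y ≢ x
    where open GappedRepeat g

  -- Each slide moves one letter of X into the gap without creating a change of letter.
  align : ∀ n (g : GappedRepeat) → length (GappedRepeat.X g) ≤ n → Σ GappedRepeat Aligned
  align n record { p = p ; s = s ; x = x ; y = y ; X = [] ; Y = Y ; u≡ = u≡ ; few = few ; long = long } _ =
    ⊥-elim (no-return x (y ∷ Y) (p , s , trans u≡ (cong (λ T → p ++ x ∷ y ∷ T) (sym (++-assoc Y [ x ] s)))) few long)
  align (suc n)
    record { p = p ; s = s ; x = x ; y = y ; X = b ∷ X ; Y = Y ; u≡ = u≡ ; few = few ; long = long } (s≤s |X|≤n)
    with lastOf b X ≟ y | lastOf y Y ≟ x
  ... | yes refl | _ with X₀ , X≡ ← ∷-lastOf b X = align n (record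
    { p = p ; s = y′ ∷ s ; x = x ; y = y′ ; X = X₀ ; Y = y′ ∷ Y
    ; u≡ = trans u≡ (trans (cong (λ T → p ++ (x ∷ T) ++ (y′ ∷ Y) ++ (x ∷ T) ++ s) X≡)
                           (slide-left p (x ∷ X₀) Y s y′))
    ; few = subst (_< k) (sym stay) few ; long = ≤-trans long (n≤1+n _) })
    (subst (_≤ n) (suc-injective (trans (cong length X≡) (length-∷ʳ X₀ y′))) |X|≤n)
    where
    y′ = lastOf b X
    stay : changes (y′ ∷ y′ ∷ Y) ≡ changes (y′ ∷ Y)
    stay with y′ ≟ y′
    ... | yes _   = refl
    ... | no y≢y = contradiction refl y≢y
  ... | no last≢y | yes refl = align n (record
    { p = p ∷ʳ x′ ; s = s ; x = b ; y = y ; X = X ; Y = Y ∷ʳ x′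
    ; u≡ = trans u≡ (slide-right p (b ∷ X) (y ∷ Y) s x′)
    ; few = subst (_< k) (sym (changes-∷ʳ-lastOf y Y)) few
    ; long = ≤-trans long (s≤s (≤-trans (n≤1+n _) (≤-reflexive (sym (length-∷ʳ Y x′))))) }) |X|≤n
    where x′ = lastOf y Y
  ... | no last≢y | no last≢x = record
    { p = p ; s = s ; x = x ; y = y ; X = b ∷ X ; Y = Y ; u≡ = u≡ ; few = few ; long = long } , last≢y , last≢x

  gap-runs : ∀ {c} y Y α → c < m → Positive α → y ∷ Y ≡ cyclicFrom m c α →
             changes (y ∷ Y) < k → k ≤ length (y ∷ Y) → 1 ≤ length α × length α ≤ k × k ≤ sum α
  gap-runs y Y []          _   _         ()
  gap-runs y Y (zero ∷ α)  _   (() ∷ _)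
  gap-runs y Y (suc e ∷ α) c<m (_ ∷ pos′) Y≡ few long =
      s≤s z≤n
    , subst (_< k) (trans (cong changes Y≡) (changes-cyclicFrom 2<m e α c<m pos′)) few
    , subst (k ≤_) (trans (cong length Y≡) (length-cyclicFrom _ (suc e ∷ α))) long

  -- The two changes of letter around Y cut w into runs α; the first copy of X is then a suffix of the runs
  -- before α and the second a prefix of the runs after α, and injectivity of cyclic words matches them up.
  locate : (g : GappedRepeat) → Aligned g → ∃ λ j → 1 ≤ j × j ≤ k × Frame k m j w
  locate g (x₁≢y , y₁≢x) =
    length α , 1≤|α| , |α|≤k ,
    frame-of-runs SC.P SC.R α C.before C.after SC.a SC.b C.a C.b k+2≤m w≡ (proj₂ same-start)
                  period |α|≤k k≤Σα
    where
    open GappedRepeat g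
    x₁ = lastOf x X
    y₁ = lastOf y Y
    X₀ = proj₁ (∷-lastOf x X)
    Y₀ = proj₁ (∷-lastOf y Y)
    X≡ : x ∷ X ≡ X₀ ∷ʳ x₁
    X≡ = proj₂ (∷-lastOf x X)
    Y≡ : y ∷ Y ≡ Y₀ ∷ʳ y₁
    Y≡ = proj₂ (∷-lastOf y Y)
    pX≡ : (p ++ X₀) ∷ʳ x₁ ≡ p ++ (x ∷ X)
    pX≡ = trans (++-assoc p X₀ [ x₁ ]) (cong (p ++_) (sym X≡))

    module B₁ = BoundaryCut (cut-at-change 0 w (p ++ X₀) x₁ y (Y ++ (x ∷ X) ++ s)
      (trans u≡ (trans (sym (++-assoc p (x ∷ X) _)) (cong (_++ (y ∷ Y) ++ (x ∷ X) ++ s) (sym pX≡)))) x₁≢y)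
    c₁ = advance m (length B₁.w₁) 0
    module B₂ = BoundaryCut (cut-at-change c₁ B₁.w₂ Y₀ y₁ x (X ++ s)
      (trans (sym B₁.q≡) (cong (_++ (x ∷ X ++ s)) Y≡)) y₁≢x)
    α = B₂.w₁
    c₂ = advance m (length α) c₁
    w≡′ : w ≡ B₁.w₁ ++ α ++ B₂.w₂
    w≡′ = trans B₁.w≡ (cong (B₁.w₁ ++_) B₂.w≡)
    pos′ : Positive (B₁.w₁ ++ α ++ B₂.w₂)
    pos′ = subst Positive w≡′ pos

    module SC = SuffixCut (cut-suffix 0 B₁.w₁ p (x ∷ X) (Allₚ.++⁻ˡ B₁.w₁ pos′) (λ ()) (trans (sym B₁.p≡) pX≡))
    module C = Cut (cut c₂ B₂.w₂ (x ∷ X) s (sym B₂.q≡) (λ ()))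
    c = advance m (length SC.P) 0

    w≡ : w ≡ (SC.P ++ (SC.a + SC.b) ∷ SC.R) ++ α ++ (C.before ++ (C.a + C.b) ∷ C.after)
    w≡ = trans w≡′ (cong₂ (λ A B → A ++ α ++ B) SC.w≡ C.w≡)

    same-start : c ≡ c₂ × SC.b ∷ SC.R ≡ C.before ∷ʳ C.a
    same-start = cyclicFrom-injective 2<m (SC.b ∷ SC.R) (C.before ∷ʳ C.a) (advance< (length SC.P) 0<m)
      (SC.1≤b ∷ R-pos) (Allₚ.++⁺ before-pos (C.1≤a ∷ [])) (λ ()) (trans (sym SC.X≡) C.p≡)
      where
      R-pos : Positive SC.R
      R-pos = All.tail (Allₚ.++⁻ʳ SC.P (subst Positive SC.w≡ (Allₚ.++⁻ˡ B₁.w₁ pos′)))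
      before-pos : Positive C.before
      before-pos = Allₚ.++⁻ˡ C.before (subst Positive C.w≡ (Allₚ.++⁻ʳ α (Allₚ.++⁻ʳ B₁.w₁ pos′)))

    gap = gap-runs y Y α (advance< (length B₁.w₁) 0<m) (Allₚ.++⁻ˡ α (Allₚ.++⁻ʳ B₁.w₁ pos′))
                   (trans Y≡ B₂.p≡) few long
    1≤|α| = proj₁ gap
    |α|≤k = proj₁ (proj₂ gap)
    k≤Σα = proj₂ (proj₂ gap)

    period : m ∣ suc (length SC.R) + length α
    period = advance-return⇒∣ (length SC.P) _ (length α)
      (trans (cong (λ A → advance m (length α) (advance m A 0)) (trans (sym (length-++ SC.P)) (cong length (sym SC.w≡))))
             (sym (proj₁ same-start)))

  gappedRepeat : ∀ p X Y s → u ≡ p ++ X ++ Y ++ X ++ s → NonEmpty X → changes Y < k → k ≤ length Y → GappedRepeat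
  gappedRepeat p []      _       s _  X≢[] _   _    = contradiction refl X≢[]
  gappedRepeat p (x ∷ X) []      s _  _    _   long = contradiction (≤-trans 1≤k long) (λ ())
  gappedRepeat p (x ∷ X) (y ∷ Y) s u≡ _    few long = record
    { p = p ; s = s ; x = x ; y = y ; X = X ; Y = Y ; u≡ = u≡ ; few = few ; long = long }

  occurrence⇒frame : PhiOccurrence k u → ∃ λ j → 1 ≤ j × j ≤ k × Frame k m j w
  occurrence⇒frame occ = uncurry locate (align _ (gappedRepeat p X Y s u≡′ X≢[] few long) ≤-refl)
    where
    open PhiOccurrence occ
    Y = concat (tabulate G)
    p = proj₁ XGX
    s = proj₁ (proj₂ XGX)
    u≡′ : u ≡ p ++ X ++ Y ++ X ++ s
    u≡′ = trans (proj₂ (proj₂ XGX)) (cong (p ++_) (trans (++-assoc X _ s) (cong (X ++_) (++-assoc Y X s))))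
    walk-Y : Linked (Step m) Y
    walk-Y = Linked-factor (p ++ X , X ++ s , trans u≡′ (sym (++-assoc p X _))) walk-u
    constant : ∀ i → changes (G i) ≡ 0
    constant i = walk-reverse-changes 2<m (G i) (Allₚ.tabulate⁻ (Linked-concat⁻ (tabulate G) walk-Y) i)
                                          (Linked-factor (mirrored i) walk-u)
    long : k ≤ length Y
    long = subst (_≤ length Y) (length-tabulate G) (length-concat-≥ (tabulate G) (Allₚ.tabulate⁺ G≢[]))
    few : changes Y < k
    few = changes-concat-tabulate G 1≤k constant

-- From a bad factor to an occurrence

frame⇒occurrence : ∀ {k m j w} .{{_ : NonZero m}} → j ≤ k → Positive w → Frame k m j w →
                   PhiOccurrence k (cyclicFrom m 0 w)
frame⇒occurrence {k} {m} j≤k pos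
  record { P = P ; mid = mid ; α = α ; S = S ; a = a ; a′ = a′ ; e = e ; e′ = e′ ; w≡ = refl
         ; a′≤a = a′≤a ; e≤e′ = e≤e′ ; length-α = refl ; k≤sum = k≤sum ; period = period } = record
  { X = X ; G = G ; X≢[] = X≢[] ; G≢[] = run≢[] ∘ G-runs
  ; XGX = subst (λ v → Factor (X ++ v ++ X) _) (sym G≡) XYX-factor ; mirrored = mirrored }
  where
  B₁ = a ∷ mid ∷ʳ e
  B₂ = a′ ∷ mid ∷ʳ e′
  c = advance m (length P) 0
  c<m : c < m
  c<m = advance< (length P) (>-nonZero⁻¹ m)
  c₁ = advance m (length B₁) c
  X = cyclicFrom m c (a′ ∷ mid ∷ʳ e)
  Y = cyclicFrom m c₁ α
  pos-core : Positive (B₁ ++ α ++ B₂)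
  pos-core = Allₚ.++⁻ˡ (B₁ ++ α ++ B₂) (Allₚ.++⁻ʳ P pos)
  X≢[] : NonEmpty X
  X≢[] = replicate-++-≢[] c _ (All.head (Allₚ.++⁻ʳ α (Allₚ.++⁻ʳ B₁ pos-core)))
  returns : advance m (length α) c₁ ≡ c
  returns = trans (sym (advance-+ m (length B₁) (length α) c))
    (Equivalence.from (advance≡⇔∣ _ c<m) (subst (λ l → m ∣ suc l + length α) (sym (length-∷ʳ mid e)) period))
  middle-factor : Factor (cyclicFrom m c (B₁ ++ α ++ B₂)) (cyclicFrom m 0 (P ++ (B₁ ++ α ++ B₂) ++ S))
  middle-factor = cyclicFrom m 0 P , cyclicFrom m (advance m (length (B₁ ++ α ++ B₂)) c) S ,
    trans (cyclicFrom-++ 0 P _) (cong (cyclicFrom m 0 P ++_) (cyclicFrom-++ c (B₁ ++ α ++ B₂) S))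
  XYX-factor : Factor (X ++ Y ++ X) (cyclicFrom m 0 (P ++ (B₁ ++ α ++ B₂) ++ S))
  XYX-factor = factor-trans (frame-factor c mid α a′≤a e≤e′ returns) middle-factor
  refined = refine k (cyclicRuns m c₁ α) (cyclicRuns-runs c₁ α (Allₚ.++⁻ˡ α (Allₚ.++⁻ʳ B₁ pos-core)))
    (subst (_≤ k) (sym (length-cyclicRuns c₁ α)) j≤k)
    (subst (k ≤_) (sym (trans (cong length (concat-cyclicRuns c₁ α)) (length-cyclicFrom c₁ α))) k≤sum)
  G = proj₁ refined
  G≡ : concat (tabulate G) ≡ Y
  G≡ = trans (proj₁ (proj₂ refined)) (concat-cyclicRuns c₁ α)
  G-runs = proj₂ (proj₂ refined)
  mirrored : ∀ i → Factor (reverse (G i)) (cyclicFrom m 0 (P ++ (B₁ ++ α ++ B₂) ++ S))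
  mirrored i = subst (λ v → Factor v _) (sym (run-reverse (G-runs i)))
    (factor-trans (subst (Factor (G i)) G≡ (factor-concat-tabulate G i)) (factor-trans (X , X , refl) XYX-factor))

module _ {k m : ℕ} .{{_ : NonZero m}} (1≤k : 1 ≤ k) (k+2≤m : suc (suc k) ≤ m)
         {w : List ℕ} (letters : All (λ a → 1 ≤ a × a ≤ suc k) w) where

  occurs⇒badFactor : Occurs (phi k) (cyclic m w) → ∃ λ j → 1 ≤ j × j ≤ k × BadFactor k m j w
  occurs⇒badFactor occ =
    let j , 1≤j , j≤k , frame = occurrence⇒frame k+2≤m 1≤k (All.map proj₁ letters) (All.map proj₂ letters)
                                                (occurs⇒phiOccurrence occ)
    in j , 1≤j , j≤k , frame⇒badFactor letters (≤-trans j≤k (≤-trans (n≤1+n k) (<⇒≤ k+2≤m))) frame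

  badFactor⇒occurs : ∀ {j} → 1 ≤ j → j ≤ k → BadFactor k m j w → Occurs (phi k) (cyclic m w)
  badFactor⇒occurs 1≤j j≤k bad = phiOccurrence⇒occurs (frame⇒occurrence j≤k (All.map proj₁ letters)
    (badFactor⇒frame 1≤j (≤-trans (s≤s (s≤s j≤k)) k+2≤m) bad))

lemma2p2 : (k m : ℕ) → 1 ≤ k → k + 2 ≤ m → (w : List ℕ) → All (λ a → 1 ≤ a × a ≤ suc k) w →
    (Avoids (phi k) (cyclic m w) ⇔ ((j : ℕ) → 1 ≤ j → j ≤ k → ¬ BadFactor k m j w))
lemma2p2 k m 1≤k k+2≤m w letters = mk⇔ to from
  where
  k+2≤m′ : suc (suc k) ≤ m
  k+2≤m′ = subst (_≤ m) (+-comm k 2) k+2≤m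
  instance
    m≢0 : NonZero m
    m≢0 = >-nonZero (≤-trans (s≤s z≤n) k+2≤m′)
  to : Avoids (phi k) (cyclic m w) → (j : ℕ) → 1 ≤ j → j ≤ k → ¬ BadFactor k m j w
  to avoids j 1≤j j≤k bad = avoids (badFactor⇒occurs 1≤k k+2≤m′ letters 1≤j j≤k bad)
  from : ((j : ℕ) → 1 ≤ j → j ≤ k → ¬ BadFactor k m j w) → Avoids (phi k) (cyclic m w)
  from no-bad occ = let j , 1≤j , j≤k , bad = occurs⇒badFactor 1≤k k+2≤m′ letters occ in no-bad j 1≤j j≤k bad
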